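{- For every positive integer $n$, $l^{*}(n)-l(n)\geq n-1$.
   Context: $l(n)$ is the least integer such that every proper edge-coloring of the complete bipartite graph $K_{n,n}$ using at least $l(n)$ colors contains a multicolored perfect matching (a perfect matching whose edges have pairwise distinct colors); equivalently, every generalized Latin square of order $n$ (an $n\times n$ matrix in which each symbol appears at most once in each row and column) with at least $l(n)$ distinct symbols has a transversal. $l^{*}(n)$ is the least integer such that every proper edge-coloring of $K_{n,n}$ using at least $l^{*}(n)$ colors has an edge set that decomposes into the disjoint union of $n$ multicolored perfect matchings. -}

module Defs where

open import Data.Nat using (ℕ; _≤_; _+_; _∸_)
open import Data.Fin using (Fin)
open import Data.Fin.Permutation using (Permutation′; _⟨$⟩ʳ_)
open import Data.Product using (Σ; ∃; ∃!; _×_; _,_)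
open import Function.Definitions using (Injective)
open import Relation.Binary.PropositionalEquality using (_≡_; _≢_)

-- An edge-colouring of K_{n,n}: edge (i , j) between left vertex i and
-- right vertex j receives colour c i j (colours are natural numbers).
-- Equivalently an n×n matrix of symbols.
Coloring : ℕ → Set
Coloring n = Fin n → Fin n → ℕ

Proper : ∀ {n} → Coloring n → Set
Proper {n} c =
  (∀ (i j j′ : Fin n) → j ≢ j′ → c i j ≢ c i j′) ×
  (∀ (i i′ j : Fin n) → i ≢ i′ → c i j ≢ c i′ j)

-- c uses at least k colours: there are k edges with pairwise distinct colours.
UsesAtLeast : ∀ {n} → ℕ → Coloring n → Set
UsesAtLeast {n} k c =
  Σ (Fin k → Fin n) λ e₁ → Σ (Fin k → Fin n) λ e₂ →
    Injective _≡_ _≡_ (λ t → c (e₁ t) (e₂ t))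

-- A perfect matching of K_{n,n} is given by a permutation σ
-- (edges (i , σ i)); it is multicolored if its edges have distinct colours.
Multicolored : ∀ {n} → Coloring n → Permutation′ n → Set
Multicolored c σ = Injective _≡_ _≡_ (λ i → c i (σ ⟨$⟩ʳ i))

DecomposesIntoMulticolored : ∀ {n} → Coloring n → Set
DecomposesIntoMulticolored {n} c =
  Σ (Fin n → Permutation′ n) λ σ →
    (∀ k → Multicolored c (σ k)) ×
    (∀ (i j : Fin n) → ∃! _≡_ (λ k → σ k ⟨$⟩ʳ i ≡ j))

LProp : ℕ → ℕ → Set
LProp n k = ∀ (c : Coloring n) → Proper c → UsesAtLeast k c →
  ∃ λ (σ : Permutation′ n) → Multicolored c σ

L*Prop : ℕ → ℕ → Set
L*Prop n k = ∀ (c : Coloring n) → Proper c → UsesAtLeast k c →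
  DecomposesIntoMulticolored c

IsLeast : (ℕ → Set) → ℕ → Set
IsLeast P m = P m × (∀ k → P k → m ≤ k)

-- Both l(n) and l*(n) exist as least witnesses because the defining properties
-- are decidable and hold for k = n²: with n² colours every edge has its own
-- colour, and the n cyclic shifts i ↦ k ⊕ i decompose K_{n,n}. Decidability
-- quantifies over all colourings; the properties only depend on which edges
-- share a colour, so it suffices to search the finitely many colourings with
-- colours in Fin (n²), using generic searchability of finite function spaces.
--
-- The inequality itself has two halves. (1) l*(n) ≥ n − 1: for n ≥ 2 the cyclic
-- Latin square (n even) or its bordering (n odd) is proper, hence uses at least
-- n colours, yet has no decomposition, because a cyclic Latin square of even
-- order has no transversal (a sum argument). (2) Padding: a proper colouring with
-- l*(n) − (n − 1) colours becomes, after recolouring n − 1 edges with fresh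
-- colours, one with l*(n) colours; it decomposes, and one of its n matchings
-- avoids all recoloured edges, so it is multicolored for the original colouring.
-- Hence l(n) ≤ l*(n) − (n − 1).
module Submission where

open import Defs
open import Data.Nat using (ℕ; suc; _≤_; _+_; _∸_)
open import Data.Product using (Σ; _×_)

open import Level using (0ℓ)
open import Data.Nat using (zero; _*_; _<_; z≤n; s≤s; NonZero; _≤?_)
open import Data.Nat.Properties
open import Data.Nat.DivMod
  using (_%_; _/_; m%n<n; m%n%n≡m%n; %-distribˡ-+; [m+n]%n≡m%n; m<n⇒m%n≡m; m≡m%n+[m/n]*n)
open import Data.Nat.Tactic.RingSolver using (solve-∀)
open import Algebra.Properties.Semiring.Sum +-*-semiring
  using (sum; sum-permute; sum-cong-≗; ∑-distrib-+; *-distribʳ-sum)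
open import Data.Fin as Fin
  using (Fin; zero; suc; toℕ; fromℕ<; punchOut; combine; remQuot; inject≤; splitAt; join; _↑ˡ_; _↑ʳ_)
open import Data.Fin.Properties
  using (any?; all?; toℕ-injective; toℕ<n; toℕ-fromℕ<; combine-injective; combine-remQuot;
         remQuot-combine; inject≤-injective; punchOut-injective; punchIn-punchOut; join-splitAt;
         splitAt-↑ˡ; splitAt-↑ʳ; injective⇒≤)
  renaming (suc-injective to Fin-suc-injective)
open import Data.Fin.Permutation as Perm using (Permutation′; _⟨$⟩ʳ_; permutation)
open import Data.Product using (∃; ∃!; _,_; proj₁; proj₂; uncurry)
open import Data.Sum using (_⊎_; inj₁; inj₂; [_,_]′)
open import Data.Sum.Properties using ([,]-∘; [,]-cong)
open import Data.Vec.Functional using (_∷_; head; tail)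
open import Data.Vec.Functional.Relation.Binary.Pointwise using (Pointwise)
open import Function using (_∘_)
open import Function.Definitions using (Injective)
open import Relation.Binary.Core using (Rel)
open import Relation.Binary.Definitions using (Reflexive; DecidableEquality; _Respects_)
open import Relation.Binary.PropositionalEquality
  using (_≡_; _≢_; refl; sym; trans; cong; cong₂; subst; _≗_; module ≡-Reasoning)
open import Relation.Nullary using (Dec; yes; no; ¬_; contradiction)
open import Relation.Nullary.Decidable using (map′; _→-dec_; _×-dec_; ¬?; decidable-stable)
open import Relation.Unary using (Pred; Decidable)

Searchable : (A : Set) → Rel A 0ℓ → Set₁
Searchable A _≈_ = ∀ {P : Pred A 0ℓ} → P Respects _≈_ → Decidable P → Dec (∃ P)

search-Fin : ∀ {n} → Searchable (Fin n) _≡_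
search-Fin _ = any?

-- Maps out of Fin m into a searchable type are searchable up to pointwise
-- equivalence: choose the value at zero, then search the remaining values.
search-→ : ∀ {A : Set} {_≈_ : Rel A 0ℓ} → Reflexive _≈_ → Searchable A _≈_ →
           ∀ m → Searchable (Fin m → A) (Pointwise _≈_)
search-→ _ _ zero {P} resp P? with P? (λ ())
... | yes p = yes ((λ ()) , p)
... | no ¬p = no λ (f , p) → ¬p (resp {f} (λ ()) p)
search-→ {_≈_ = _≈_} refl≈ search (suc m) {P} resp P? =
  map′ (λ (a , g , p) → a ∷ g , p) (λ (f , p) → head f , tail f , resp η p)
       (search (λ a≈b (g , p) → g , resp (cons a≈b (λ _ → refl≈)) p)
               (λ a → search-→ refl≈ search m (resp ∘ cons refl≈) (P? ∘ (a ∷_))))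
  where
  cons : ∀ {a b g h} → a ≈ b → Pointwise _≈_ g h → Pointwise _≈_ (a ∷ g) (b ∷ h)
  cons a≈b _   zero    = a≈b
  cons _   g≈h (suc i) = g≈h i
  η : ∀ {f} → Pointwise _≈_ f (head f ∷ tail f)
  η zero    = refl≈
  η (suc i) = refl≈

injective? : ∀ {m} {B : Set} → DecidableEquality B → (f : Fin m → B) → Dec (Injective _≡_ _≡_ f)
injective? _≟_ f = map′ (λ inj {x} {y} → inj x y) (λ inj x y → inj)
  (all? λ x → all? λ y → f x ≟ f y →-dec x Fin.≟ y)

injective-resp : ∀ {A B : Set} {f g : A → B} → f ≗ g → Injective _≡_ _≡_ f → Injective _≡_ _≡_ g
injective-resp f≗g inj eq = inj (trans (f≗g _) (trans eq (sym (f≗g _))))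

-- An injective endomap of Fin n is onto: a missed value j could be punched
-- out, giving an injection Fin (suc n) → Fin n.
injective⇒onto : ∀ {n} {f : Fin n → Fin n} → Injective _≡_ _≡_ f → ∀ j → ∃ λ i → f i ≡ j
injective⇒onto {suc n} {f} inj j with any? (λ i → f i Fin.≟ j)
... | yes found = found
... | no missed = contradiction (injective⇒≤ punched-injective) (<-irrefl refl)
  where
  hit : ∀ i → j ≢ f i
  hit i j≡fi = missed (i , sym j≡fi)
  punched : Fin (suc n) → Fin n
  punched i = punchOut (hit i)
  punched-injective : Injective _≡_ _≡_ punched
  punched-injective eq = inj (punchOut-injective (hit _) (hit _) eq)

toPermutation : ∀ {n} (f : Fin n → Fin n) → Injective _≡_ _≡_ f → Permutation′ n
toPermutation f inj = permutation f (proj₁ ∘ onto) (proj₂ ∘ onto) (λ i → inj (proj₂ (onto (f i))))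
  where onto = injective⇒onto inj

permutation-injective : ∀ {n} (σ : Permutation′ n) → Injective _≡_ _≡_ (σ ⟨$⟩ʳ_)
permutation-injective σ eq =
  trans (sym (Perm.inverseˡ σ)) (trans (cong (σ Perm.⟨$⟩ˡ_) eq) (Perm.inverseˡ σ))

-- Permutations are searchable up to equality of their forward maps, by
-- searching over the injective endomaps of Fin n.
search-Perm : ∀ {n} → Searchable (Permutation′ n) Perm._≈_
search-Perm {n} {P} resp P? =
  map′ (λ (f , inj , p) → toPermutation f inj , p)
       (λ (σ , p) → (σ ⟨$⟩ʳ_) , (λ {x y} → permutation-injective σ) , resp (λ _ → refl) p)
       (search-→ refl search-Fin n resp′ Q?)
  where
  Q : Pred (Fin n → Fin n) 0ℓ
  Q f = Σ (Injective _≡_ _≡_ f) λ inj → P (toPermutation f inj)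
  resp′ : Q Respects Pointwise _≡_
  resp′ f≗g (inj , p) = injective-resp f≗g inj , resp f≗g p
  Q? : Decidable Q
  Q? f with injective? Fin._≟_ f
  ... | yes inj = map′ (inj ,_) (λ (_ , p) → resp (λ _ → refl) p) (P? (toPermutation f inj))
  ... | no ¬inj = no (¬inj ∘ proj₁)

missed-value : ∀ {a N} (g : Fin a → Fin N) → a < N → ∃ λ x → ∀ i → g i ≢ x
missed-value {a} {N} g a<N with any? (λ x → ¬? (any? (λ i → g i Fin.≟ x)))
... | yes (x , unhit) = x , λ i gi≡x → unhit (i , gi≡x)
... | no allHit = contradiction (injective⇒≤ preimage-injective) (<⇒≱ a<N)
  where
  preimage : ∀ x → ∃ λ i → g i ≡ x
  preimage x with any? (λ i → g i Fin.≟ x)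
  ... | yes hit = hit
  ... | no unhit = contradiction (x , unhit) allHit
  preimage-injective : Injective _≡_ _≡_ (proj₁ ∘ preimage)
  preimage-injective {x} {y} eq =
    trans (sym (proj₂ (preimage x))) (trans (cong g eq) (proj₂ (preimage y)))

least : ∀ {P : ℕ → Set} → Decidable P → ∀ {b} → P b → ∃ (IsLeast P)
least {P} P? {b} pb = scan b 0 (λ _ ()) (subst P (sym (+-identityʳ b)) pb)
  where
  -- scan d j: nothing below j satisfies P, but d + j does.
  scan : ∀ d j → (∀ k → k < j → ¬ P k) → P (d + j) → ∃ (IsLeast P)
  scan d j below p with P? j
  ... | yes pj = j , pj , λ k pk → ≮⇒≥ (λ k<j → below k k<j pk)
  scan zero    j below p | no ¬pj = contradiction p ¬pj
  scan (suc d) j below p | no ¬pj = scan d (suc j) below′ (subst P (sym (+-suc d j)) p)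
    where
    below′ : ∀ k → k < suc j → ¬ P k
    below′ k k<1+j with m<1+n⇒m<n∨m≡n k<1+j
    ... | inj₁ k<j  = below k k<j
    ... | inj₂ refl = ¬pj

_⊕_ : ∀ {n} .{{_ : NonZero n}} → Fin n → Fin n → Fin n
_⊕_ {n} a b = fromℕ< (m%n<n (toℕ a + toℕ b) n)

toℕ-⊕ : ∀ {n} .{{_ : NonZero n}} (a b : Fin n) → toℕ (a ⊕ b) ≡ (toℕ a + toℕ b) % n
toℕ-⊕ a b = toℕ-fromℕ< _

⊕-comm : ∀ {n} .{{_ : NonZero n}} (a b : Fin n) → a ⊕ b ≡ b ⊕ a
⊕-comm {n} a b = toℕ-injective (begin
  toℕ (a ⊕ b)            ≡⟨ toℕ-⊕ a b ⟩
  (toℕ a + toℕ b) % n    ≡⟨ cong (_% n) (+-comm (toℕ a) (toℕ b)) ⟩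
  (toℕ b + toℕ a) % n    ≡⟨ toℕ-⊕ b a ⟨
  toℕ (b ⊕ a)            ∎)
  where open ≡-Reasoning

⊕-recover : ∀ {n} .{{_ : NonZero n}} (a b : Fin n) → (toℕ (a ⊕ b) + (n ∸ toℕ a)) % n ≡ toℕ b
⊕-recover {n} a b = begin
  (toℕ (a ⊕ b) + (n ∸ x)) % n          ≡⟨ cong (λ z → (z + (n ∸ x)) % n) (toℕ-⊕ a b) ⟩
  ((x + y) % n + (n ∸ x)) % n          ≡⟨ %-distribˡ-+ ((x + y) % n) (n ∸ x) n ⟩
  ((x + y) % n % n + (n ∸ x) % n) % n  ≡⟨ cong (λ z → (z + (n ∸ x) % n) % n) (m%n%n≡m%n (x + y) n) ⟩
  ((x + y) % n + (n ∸ x) % n) % n      ≡⟨ %-distribˡ-+ (x + y) (n ∸ x) n ⟨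
  (x + y + (n ∸ x)) % n                ≡⟨ cong (_% n) rearrange ⟩
  (y + n) % n                          ≡⟨ [m+n]%n≡m%n y n ⟩
  y % n                                ≡⟨ m<n⇒m%n≡m (toℕ<n b) ⟩
  y                                    ∎
  where
  open ≡-Reasoning
  x = toℕ a
  y = toℕ b
  rearrange : x + y + (n ∸ x) ≡ y + n
  rearrange = trans (cong (_+ (n ∸ x)) (+-comm x y))
                    (trans (+-assoc y x (n ∸ x)) (cong (y +_) (m+[n∸m]≡n (<⇒≤ (toℕ<n a)))))

⊕-cancelˡ : ∀ {n} .{{_ : NonZero n}} (a : Fin n) → Injective _≡_ _≡_ (a ⊕_)
⊕-cancelˡ {n} a {b} {b′} eq = toℕ-injective (begin
  toℕ b                                ≡⟨ ⊕-recover a b ⟨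
  (toℕ (a ⊕ b) + (n ∸ toℕ a)) % n      ≡⟨ cong (λ z → (toℕ z + (n ∸ toℕ a)) % n) eq ⟩
  (toℕ (a ⊕ b′) + (n ∸ toℕ a)) % n     ≡⟨ ⊕-recover a b′ ⟩
  toℕ b′                               ∎)
  where open ≡-Reasoning

sum-suc : ∀ {n} (f : Fin n → ℕ) → sum (λ i → suc (f i)) ≡ n + sum f
sum-suc {zero}  f = refl
sum-suc {suc n} f = begin
  suc (f zero) + sum (λ i → suc (f (suc i)))  ≡⟨ cong (suc (f zero) +_) (sum-suc (f ∘ suc)) ⟩
  suc (f zero) + (n + sum (f ∘ suc))          ≡⟨ cong suc (x+[y+z]≡y+[x+z] (f zero) n _) ⟩
  suc n + (f zero + sum (f ∘ suc))            ∎
  where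
  open ≡-Reasoning
  x+[y+z]≡y+[x+z] : ∀ x y z → x + (y + z) ≡ y + (x + z)
  x+[y+z]≡y+[x+z] = solve-∀

triangular : ∀ n → 2 * sum {n} toℕ + n ≡ n * n
triangular zero    = refl
triangular (suc n) = begin
  2 * sum {suc n} toℕ + suc n          ≡⟨ cong (λ s → 2 * s + suc n) (sum-suc {n} toℕ) ⟩
  2 * (n + T) + suc n                  ≡⟨ regroup n T ⟩
  (2 * T + n) + (2 * n + 1)            ≡⟨ cong (_+ (2 * n + 1)) (triangular n) ⟩
  n * n + (2 * n + 1)                  ≡⟨ square n ⟩
  suc n * suc n                        ∎
  where
  open ≡-Reasoning
  T = sum {n} toℕ
  regroup : ∀ n T → 2 * (n + T) + suc n ≡ (2 * T + n) + (2 * n + 1)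
  regroup = solve-∀
  square : ∀ n → n * n + (2 * n + 1) ≡ suc n * suc n
  square = solve-∀

sum-injective : ∀ {n} (f : Fin n → Fin n) → Injective _≡_ _≡_ f → sum (toℕ ∘ f) ≡ sum {n} toℕ
sum-injective f inj = sym (sum-permute toℕ (toPermutation f inj))

-- The cyclic Latin square of order n has a transversal only if n is odd:
-- writing i + ρ i = (i ⊕ ρ i) + n·qᵢ and summing over i, both ρ and i ↦ i ⊕ ρ i
-- permute Fin n, so 2S = S + n·Q for S = Σ i; with 2S + n = n² this gives n = 2Q + 1.
cyclic-transversal⇒odd : ∀ {n} .{{_ : NonZero n}} (ρ : Fin n → Fin n) →
  Injective _≡_ _≡_ ρ → Injective _≡_ _≡_ (λ i → i ⊕ ρ i) → ∃ λ q → n ≡ suc (2 * q)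
cyclic-transversal⇒odd {n} ρ ρ-inj τ-inj = Q , sym (*-cancelˡ-≡ (suc (2 * Q)) n n n[1+2Q]≡n²)
  where
  open ≡-Reasoning
  S = sum {n} toℕ
  x : Fin n → ℕ
  x i = toℕ i + toℕ (ρ i)
  Q = sum (λ i → x i / n)
  τ : Fin n → Fin n
  τ i = i ⊕ ρ i
  x-split : ∀ i → x i ≡ toℕ (τ i) + x i / n * n
  x-split i = trans (m≡m%n+[m/n]*n (x i) n) (cong (_+ x i / n * n) (sym (toℕ-⊕ i (ρ i))))
  S+S≡S+Q*n : S + S ≡ S + Q * n
  S+S≡S+Q*n = begin
    S + S                                              ≡⟨ cong (S +_) (sum-injective ρ ρ-inj) ⟨
    S + sum (toℕ ∘ ρ)                                  ≡⟨ ∑-distrib-+ toℕ (toℕ ∘ ρ) ⟨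
    sum x                                              ≡⟨ sum-cong-≗ x-split ⟩
    sum (λ i → toℕ (τ i) + x i / n * n)                ≡⟨ ∑-distrib-+ (toℕ ∘ τ) _ ⟩
    sum (toℕ ∘ τ) + sum (λ i → x i / n * n)            ≡⟨ cong₂ _+_ (sum-injective τ τ-inj)
                                                                   (sym (*-distribʳ-sum n (λ i → x i / n))) ⟩
    S + Q * n                                          ∎
  n[1+2Q]≡n² : n * suc (2 * Q) ≡ n * n
  n[1+2Q]≡n² = begin
    n * suc (2 * Q)      ≡⟨ expand n Q ⟩
    2 * (Q * n) + n      ≡⟨ cong (λ s → 2 * s + n) (+-cancelˡ-≡ S S (Q * n) S+S≡S+Q*n) ⟨
    2 * S + n            ≡⟨ triangular n ⟩
    n * n                ∎
    where
    expand : ∀ n Q → n * suc (2 * Q) ≡ 2 * (Q * n) + n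
    expand = solve-∀

-- c ⊑ d: every colour class of c lies inside a colour class of d, i.e. d arises
-- from c by identifying colours.
_⊑_ : ∀ {n} → Coloring n → Coloring n → Set
c ⊑ d = ∀ i j i′ j′ → c i j ≡ c i′ j′ → d i j ≡ d i′ j′

≗⇒⊑ : ∀ {n} {c d : Coloring n} → (∀ i j → c i j ≡ d i j) → c ⊑ d
≗⇒⊑ c≗d i j i′ j′ eq = trans (sym (c≗d i j)) (trans eq (c≗d i′ j′))

rainbow-⊑ : ∀ {n} {c d : Coloring n} → c ⊑ d → ∀ {X : Set} (e₁ e₂ : X → Fin n) →
  Injective _≡_ _≡_ (λ x → d (e₁ x) (e₂ x)) → Injective _≡_ _≡_ (λ x → c (e₁ x) (e₂ x))
rainbow-⊑ c⊑d _ _ inj eq = inj (c⊑d _ _ _ _ eq)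

proper-⊑ : ∀ {n} {c d : Coloring n} → c ⊑ d → Proper d → Proper c
proper-⊑ c⊑d (rows , cols) =
  (λ i j j′ j≢j′ eq → rows i j j′ j≢j′ (c⊑d _ _ _ _ eq)) ,
  (λ i i′ j i≢i′ eq → cols i i′ j i≢i′ (c⊑d _ _ _ _ eq))

usesAtLeast-⊑ : ∀ {n k} {c d : Coloring n} → c ⊑ d → UsesAtLeast k d → UsesAtLeast k c
usesAtLeast-⊑ c⊑d (e₁ , e₂ , inj) = e₁ , e₂ , rainbow-⊑ c⊑d e₁ e₂ inj

multicolored-⊑ : ∀ {n} {c d : Coloring n} → c ⊑ d → ∀ σ → Multicolored d σ → Multicolored c σ
multicolored-⊑ c⊑d σ = rainbow-⊑ c⊑d (λ i → i) (σ ⟨$⟩ʳ_)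

HasMulticolored : ∀ {n} → Coloring n → Set
HasMulticolored c = ∃ λ σ → Multicolored c σ

hasMulticolored-⊑ : ∀ {n} {c d : Coloring n} → c ⊑ d → HasMulticolored d → HasMulticolored c
hasMulticolored-⊑ c⊑d (σ , mc) = σ , multicolored-⊑ c⊑d σ mc

decomposes-⊑ : ∀ {n} {c d : Coloring n} → c ⊑ d → DecomposesIntoMulticolored d → DecomposesIntoMulticolored c
decomposes-⊑ c⊑d (σ , mc , cover) = σ , (λ k → multicolored-⊑ c⊑d (σ k) (mc k)) , cover

Forces : ∀ {n} → ℕ → (Coloring n → Set) → Coloring n → Set
Forces k Good c = Proper c → UsesAtLeast k c → Good c

-- Properties that do not depend on the names of the colours.
PatternInvariant : ∀ {n} → (Coloring n → Set) → Set
PatternInvariant R = ∀ {c d} → c ⊑ d → d ⊑ c → R c → R d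

forces-invariant : ∀ {n k} {Good : Coloring n → Set} →
  (∀ {c d} → c ⊑ d → Good d → Good c) → PatternInvariant (Forces k Good)
forces-invariant good-⊑ c⊑d d⊑c forced proper uses =
  good-⊑ d⊑c (forced (proper-⊑ c⊑d proper) (usesAtLeast-⊑ c⊑d uses))

proper? : ∀ {n} (c : Coloring n) → Dec (Proper c)
proper? c = (all? λ i → all? λ j → all? λ j′ → ¬? (j Fin.≟ j′) →-dec ¬? (c i j ≟ c i j′))
      ×-dec (all? λ i → all? λ i′ → all? λ j → ¬? (i Fin.≟ i′) →-dec ¬? (c i j ≟ c i′ j))

usesAtLeast? : ∀ {n} k (c : Coloring n) → Dec (UsesAtLeast k c)
usesAtLeast? k c = search-→ refl search-Fin k resp₁ λ e₁ →
  search-→ refl search-Fin k (resp₂ e₁) λ e₂ → injective? _≟_ _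
  where
  resp₂ : ∀ e₁ → (λ e₂ → Injective _≡_ _≡_ (λ t → c (e₁ t) (e₂ t))) Respects Pointwise _≡_
  resp₂ e₁ e₂≗e₂′ = injective-resp (λ t → cong (c (e₁ t)) (e₂≗e₂′ t))
  resp₁ : (λ e₁ → ∃ λ e₂ → Injective _≡_ _≡_ (λ t → c (e₁ t) (e₂ t))) Respects Pointwise _≡_
  resp₁ e₁≗e₁′ (e₂ , inj) = e₂ , injective-resp (λ t → cong (λ i → c i (e₂ t)) (e₁≗e₁′ t)) inj

multicolored-resp : ∀ {n} (c : Coloring n) → Multicolored c Respects Perm._≈_
multicolored-resp c σ≈τ = injective-resp (λ i → cong (c i) (σ≈τ i))

hasMulticolored? : ∀ {n} (c : Coloring n) → Dec (HasMulticolored c)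
hasMulticolored? c = search-Perm (λ {σ τ} → multicolored-resp c {σ} {τ})
  λ σ → injective? _≟_ (λ i → c i (σ ⟨$⟩ʳ i))

unique? : ∀ {n} {P : Fin n → Set} → Decidable P → Dec (∃! _≡_ P)
unique? P? = map′ (λ (k , pk , only) → k , pk , λ pk′ → only _ pk′)
                  (λ (k , pk , only) → k , pk , λ _ → only)
                  (any? λ k → P? k ×-dec all? λ k′ → P? k′ →-dec k Fin.≟ k′)

decomposes? : ∀ {n} (c : Coloring n) → Dec (DecomposesIntoMulticolored c)
decomposes? {n} c = search-→ (λ _ → refl) search-Perm n (λ {σ τ} → resp {σ} {τ})
  λ σ → all? (λ k → injective? _≟_ (λ i → c i (σ k ⟨$⟩ʳ i)))
  ×-dec all? λ i → all? λ j → unique? λ k → σ k ⟨$⟩ʳ i Fin.≟ j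
  where
  resp : (λ σ → (∀ k → Multicolored c (σ k)) × (∀ i j → ∃! _≡_ λ k → σ k ⟨$⟩ʳ i ≡ j))
         Respects Pointwise Perm._≈_
  resp {σ} {τ} σ≈τ (mc , cover) = (λ k → multicolored-resp c {σ k} {τ k} (σ≈τ k) (mc k)) ,
    λ i j → let (k , σki≡j , only) = cover i j in
      k , trans (sym (σ≈τ k i)) σki≡j , λ {k′} τk′i≡j → only {k′} (trans (σ≈τ k′ i) τk′i≡j)

-- The first cell, in search order, carrying colour x (the corner if there is none).
firstCell : ∀ {n} → Coloring (suc n) → ℕ → Fin (suc n) × Fin (suc n)
firstCell c x with any? (λ i → any? (λ j → c i j ≟ x))
... | yes (i , j , _) = i , j
... | no _            = zero , zero

firstCell-colour : ∀ {n} (c : Coloring (suc n)) i j → uncurry c (firstCell c (c i j)) ≡ c i j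
firstCell-colour c i j with any? (λ i′ → any? (λ j′ → c i′ j′ ≟ c i j))
... | yes (_ , _ , found) = found
... | no none             = contradiction (i , j , refl) none

-- Renaming every colour to the code of its first cell gives a colouring with
-- colours in Fin (n²) and the same colour classes.
canonical : ∀ {n} → Coloring (suc n) → Fin (suc n) → Fin (suc n) → Fin (suc n * suc n)
canonical c i j = uncurry combine (firstCell c (c i j))

numbered : ∀ {n N} → (Fin n → Fin n → Fin N) → Coloring n
numbered D i j = toℕ (D i j)

⊑-canonical : ∀ {n} (c : Coloring (suc n)) → c ⊑ numbered (canonical c)
⊑-canonical c i j i′ j′ eq = cong (λ x → toℕ (uncurry combine (firstCell c x))) eq

canonical-⊑ : ∀ {n} (c : Coloring (suc n)) → numbered (canonical c) ⊑ c
canonical-⊑ c i j i′ j′ eq = begin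
  c i j                             ≡⟨ firstCell-colour c i j ⟨
  uncurry c (firstCell c (c i j))   ≡⟨ cong (uncurry c) same-cell ⟩
  uncurry c (firstCell c (c i′ j′)) ≡⟨ firstCell-colour c i′ j′ ⟩
  c i′ j′                           ∎
  where
  open ≡-Reasoning
  same-cell : firstCell c (c i j) ≡ firstCell c (c i′ j′)
  same-cell with combine-injective _ _ _ _ (toℕ-injective eq)
  ... | i≡ , j≡ = cong₂ _,_ i≡ j≡

-- A pattern-invariant property of colourings of K_{n,n} is decidable for all
-- colourings once it is decidable for each: it suffices to search the finitely
-- many colourings with colours in Fin (n²).
decide-∀ : ∀ {n} {R : Coloring (suc n) → Set} → PatternInvariant R →
           (∀ c → Dec (R c)) → Dec (∀ c → R c)
decide-∀ {n} {R} invariant R? = map′ from-canonical to-canonical (¬? (search-→ (λ _ → refl)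
  (search-→ refl search-Fin (suc n)) (suc n) fails-resp (λ D → ¬? (R? (numbered D)))))
  where
  fails-resp : (λ D → ¬ R (numbered D)) Respects Pointwise (Pointwise _≡_)
  fails-resp D≗D′ ¬r r = ¬r (invariant (≗⇒⊑ D′≗D) (≗⇒⊑ (λ i j → sym (D′≗D i j))) r)
    where D′≗D = λ i j → cong toℕ (sym (D≗D′ i j))
  from-canonical : ¬ (∃ λ D → ¬ R (numbered D)) → ∀ c → R c
  from-canonical none c = invariant (canonical-⊑ c) (⊑-canonical c)
    (decidable-stable (R? _) (λ ¬r → none (canonical c , ¬r)))
  to-canonical : (∀ c → R c) → ¬ (∃ λ D → ¬ R (numbered D))
  to-canonical holds (D , fails) = fails (holds (numbered D))

LProp? : ∀ n k → Dec (LProp (suc n) k)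
LProp? n k = decide-∀ (forces-invariant hasMulticolored-⊑)
  λ c → proper? c →-dec (usesAtLeast? k c →-dec hasMulticolored? c)

L*Prop? : ∀ n k → Dec (L*Prop (suc n) k)
L*Prop? n k = decide-∀ (forces-invariant decomposes-⊑)
  λ c → proper? c →-dec (usesAtLeast? k c →-dec decomposes? c)

-- With n² colours every edge is one of the n² witness edges, so every edge
-- has its own colour.
rainbow-edges : ∀ {n} {c : Coloring n} → UsesAtLeast (n * n) c →
  ∀ {i j i′ j′} → c i j ≡ c i′ j′ → i ≡ i′ × j ≡ j′
rainbow-edges {n} {c} (e₁ , e₂ , inj) {i} {j} {i′} {j′} eq =
  trans (sym (proj₁ (edge i j))) (trans (cong e₁ t≡t′) (proj₁ (edge i′ j′))) ,
  trans (sym (proj₂ (edge i j))) (trans (cong e₂ t≡t′) (proj₂ (edge i′ j′)))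
  where
  code : Fin (n * n) → Fin (n * n)
  code t = combine (e₁ t) (e₂ t)
  code-injective : Injective _≡_ _≡_ code
  code-injective codes≡ = inj (uncurry (cong₂ c) (combine-injective _ _ _ _ codes≡))
  witness : Fin n → Fin n → Fin (n * n)
  witness i j = proj₁ (injective⇒onto code-injective (combine i j))
  edge : ∀ i j → e₁ (witness i j) ≡ i × e₂ (witness i j) ≡ j
  edge i j = combine-injective _ _ _ _ (proj₂ (injective⇒onto code-injective (combine i j)))
  t≡t′ : witness i j ≡ witness i′ j′
  t≡t′ = inj (trans (cong₂ c (proj₁ (edge i j)) (proj₂ (edge i j)))
             (trans eq (sym (cong₂ c (proj₁ (edge i′ j′)) (proj₂ (edge i′ j′))))))

shift : ∀ {n} .{{_ : NonZero n}} → Fin n → Permutation′ n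
shift k = toPermutation (k ⊕_) (⊕-cancelˡ k)

shifts-cover : ∀ {n} .{{_ : NonZero n}} (i j : Fin n) → ∃! _≡_ λ k → shift k ⟨$⟩ʳ i ≡ j
shifts-cover i j with injective⇒onto (⊕-cancelˡ i) j
... | k , i⊕k≡j = k , trans (⊕-comm k i) i⊕k≡j ,
  λ {k′} k′⊕i≡j → ⊕-cancelˡ i (trans i⊕k≡j (sym (trans (⊕-comm i k′) k′⊕i≡j)))

L*Prop-n² : ∀ n → L*Prop (suc n) (suc n * suc n)
L*Prop-n² n c _ uses = shift , (λ k eq → proj₁ (rainbow-edges {suc n} {c} uses eq)) , shifts-cover

decomposition⇒matching : ∀ {n} {c : Coloring (suc n)} → DecomposesIntoMulticolored c → HasMulticolored c
decomposition⇒matching (σ , multicolored , _) = σ zero , multicolored zero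

LProp-n² : ∀ n → LProp (suc n) (suc n * suc n)
LProp-n² n c proper uses = decomposition⇒matching {n} {c} (L*Prop-n² n c proper uses)

-- A proper colouring of K_{n,n} uses at least n colours (those of one column).
proper⇒usesAtLeast : ∀ {n k} (c : Coloring (suc n)) → Proper c → k ≤ suc n → UsesAtLeast k c
proper⇒usesAtLeast c (_ , cols) k≤n = row , (λ _ → zero) ,
  λ {t} {t′} eq → inject≤-injective k≤n k≤n t t′
    (decidable-stable (row t Fin.≟ row t′) (λ rows≢ → cols _ _ zero rows≢ eq))
  where row = λ t → inject≤ t k≤n

cyclic : ∀ n .{{_ : NonZero n}} → Coloring n
cyclic n i j = toℕ (i ⊕ j)

cyclic-proper : ∀ n .{{_ : NonZero n}} → Proper (cyclic n)
cyclic-proper n =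
  (λ i j j′ j≢j′ eq → j≢j′ (⊕-cancelˡ i (toℕ-injective eq))) ,
  (λ i i′ j i≢i′ eq → i≢i′ (⊕-cancelˡ j (toℕ-injective
     (trans (cong toℕ (⊕-comm j i)) (trans eq (cong toℕ (⊕-comm i′ j)))))))

cyclic-even-undecomposable : ∀ h → ¬ DecomposesIntoMulticolored (cyclic (2 * suc h))
cyclic-even-undecomposable h (σ , multicolored , _) =
  even≢odd (suc h) (proj₁ odd) (proj₂ odd)
  where
  odd = cyclic-transversal⇒odd (σ zero ⟨$⟩ʳ_) (permutation-injective (σ zero))
          (λ eq → multicolored zero (cong toℕ eq))

border : ∀ {m} → ℕ → Coloring m → Coloring (suc m)
border B c zero    j       = B + toℕ j
border B c (suc i) zero    = B + toℕ (suc i)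
border B c (suc i) (suc j) = c i j

border-proper : ∀ {m B} {c : Coloring m} → (∀ i j → c i j < B) → Proper c → Proper (border B c)
border-proper {B = B} {c} below (rows , cols) = rows′ , cols′
  where
  fresh≢old : ∀ x i j → B + x ≢ c i j
  fresh≢old x i j eq = <⇒≢ (<-≤-trans (below i j) (m≤m+n B x)) (sym eq)
  fresh≢fresh : ∀ {m} {x y : Fin m} → x ≢ y → B + toℕ x ≢ B + toℕ y
  fresh≢fresh x≢y eq = x≢y (toℕ-injective (+-cancelˡ-≡ B _ _ eq))
  rows′ : ∀ i j j′ → j ≢ j′ → border B c i j ≢ border B c i j′
  rows′ zero    j       j′       j≢j′ = fresh≢fresh j≢j′
  rows′ (suc i) zero    zero     0≢0  = contradiction refl 0≢0
  rows′ (suc i) zero    (suc j′) _    = fresh≢old _ i j′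
  rows′ (suc i) (suc j) zero     _    = fresh≢old _ i j ∘ sym
  rows′ (suc i) (suc j) (suc j′) j≢j′ = rows i j j′ (j≢j′ ∘ cong suc)
  cols′ : ∀ i i′ j → i ≢ i′ → border B c i j ≢ border B c i′ j
  cols′ zero    zero     j       0≢0  = contradiction refl 0≢0
  cols′ zero    (suc i′) zero    i≢i′ = fresh≢fresh i≢i′
  cols′ (suc i) zero     zero    i≢i′ = fresh≢fresh i≢i′
  cols′ (suc i) (suc i′) zero    i≢i′ = fresh≢fresh i≢i′
  cols′ zero    (suc i′) (suc j) _    = fresh≢old _ i′ j
  cols′ (suc i) zero     (suc j) _    = fresh≢old _ i j ∘ sym
  cols′ (suc i) (suc i′) (suc j) i≢i′ = cols i i′ j (i≢i′ ∘ cong suc)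

border-transversal : ∀ {m B} {c : Coloring m} (σ : Permutation′ (suc m)) →
  Multicolored (border B c) σ → σ ⟨$⟩ʳ zero ≡ zero →
  ∃ λ (ρ : Fin m → Fin m) → Injective _≡_ _≡_ ρ × Injective _≡_ _≡_ (λ i → c i (ρ i))
border-transversal {B = B} {c} σ multicolored corner = ρ , ρ-injective , colours-injective
  where
  avoids : ∀ i → zero ≢ σ ⟨$⟩ʳ suc i
  avoids i eq with permutation-injective σ (trans corner eq)
  ... | ()
  ρ : Fin _ → Fin _
  ρ i = punchOut (avoids i)
  suc-ρ : ∀ i → suc (ρ i) ≡ σ ⟨$⟩ʳ suc i
  suc-ρ i = punchIn-punchOut (avoids i)
  ρ-injective : Injective _≡_ _≡_ ρ
  ρ-injective eq = Fin-suc-injective (permutation-injective σ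
    (trans (sym (suc-ρ _)) (trans (cong suc eq) (suc-ρ _))))
  colour : ∀ i → c i (ρ i) ≡ border B c (suc i) (σ ⟨$⟩ʳ suc i)
  colour i = cong (border B c (suc i)) (suc-ρ i)
  colours-injective : Injective _≡_ _≡_ (λ i → c i (ρ i))
  colours-injective eq = Fin-suc-injective (multicolored (trans (sym (colour _)) (trans eq (colour _))))

-- For odd n = 2h + 3, the bordered cyclic colouring of order 2h + 2 has no
-- decomposition: the matching through the corner would give an even-order transversal.
bordered-undecomposable : ∀ h → let m = 2 * suc h in ¬ DecomposesIntoMulticolored (border m (cyclic m))
bordered-undecomposable h (σ , multicolored , cover) = even≢odd (suc h) (proj₁ odd) (proj₂ odd)
  where
  corner = cover zero zero
  transversal = border-transversal (σ (proj₁ corner)) (multicolored (proj₁ corner)) (proj₁ (proj₂ corner))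
  odd = cyclic-transversal⇒odd (proj₁ transversal) (proj₁ (proj₂ transversal))
          (λ eq → proj₂ (proj₂ transversal) (cong toℕ eq))

parity : ∀ n → ∃ λ h → n ≡ 2 * h ⊎ n ≡ suc (2 * h)
parity zero    = 0 , inj₁ refl
parity (suc n) with parity n
... | h , inj₁ n≡2h   = h , inj₂ (cong suc n≡2h)
... | h , inj₂ n≡2h+1 = suc h , inj₁ (trans (cong suc n≡2h+1) (sym (*-suc 2 h)))

undecomposable : ∀ n → 2 ≤ n → ∃ λ (c : Coloring n) → Proper c × ¬ DecomposesIntoMulticolored c
undecomposable n 2≤n with parity n
... | zero  , inj₁ refl = contradiction 2≤n λ ()
... | zero  , inj₂ refl = contradiction 2≤n λ { (s≤s ()) }
... | suc h , inj₁ refl = cyclic _ , cyclic-proper _ , cyclic-even-undecomposable h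
... | suc h , inj₂ refl = border _ (cyclic _) , border-proper (λ i j → toℕ<n (i ⊕ j)) (cyclic-proper _) ,
                          bordered-undecomposable h

-- Lower bound: the colourings above use at least n colours, so l*(n) ≥ n − 1.
L*Prop⇒n∸1≤ : ∀ n k → L*Prop n k → n ∸ 1 ≤ k
L*Prop⇒n∸1≤ zero          k _ = z≤n
L*Prop⇒n∸1≤ (suc zero)    k _ = z≤n
L*Prop⇒n∸1≤ (suc (suc n)) k forced with suc n ≤? k
... | yes n+1≤k = n+1≤k
... | no n+1≰k  = contradiction (forced c proper (proper⇒usesAtLeast c proper k≤n+2)) ¬decomposes
  where
  bad = undecomposable (suc (suc n)) (s≤s (s≤s z≤n))
  c = proj₁ bad
  proper = proj₁ (proj₂ bad)
  ¬decomposes = proj₂ (proj₂ bad)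
  k≤n+2 : k ≤ suc (suc n)
  k≤n+2 = ≤-trans (<⇒≤ (≰⇒> n+1≰k)) (n≤1+n (suc n))

joined : ∀ {a b} {X : Set} → (Fin a → X) → (Fin b → X) → Fin (a + b) → X
joined {a} f g x = [ f , g ]′ (splitAt a x)

joined-injective : ∀ {a b} {X : Set} {f : Fin a → X} {g : Fin b → X} →
  Injective _≡_ _≡_ f → Injective _≡_ _≡_ g → (∀ s t → f s ≢ g t) → Injective _≡_ _≡_ (joined f g)
joined-injective {a} {b} {f = f} {g} f-inj g-inj apart {x} {y} eq =
  trans (sym (join-splitAt a b x))
        (trans (cong (join a b) (halves-injective (splitAt a x) (splitAt a y) eq)) (join-splitAt a b y))
  where
  halves-injective : ∀ u v → [ f , g ]′ u ≡ [ f , g ]′ v → u ≡ v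
  halves-injective (inj₁ s) (inj₁ s′) eq = cong inj₁ (f-inj eq)
  halves-injective (inj₂ t) (inj₂ t′) eq = cong inj₂ (g-inj eq)
  halves-injective (inj₁ s) (inj₂ t)  eq = contradiction eq (apart s t)
  halves-injective (inj₂ t) (inj₁ s)  eq = contradiction (sym eq) (apart s t)

avoiding : ∀ {m N} p (w : Fin m → Fin N) → m + p ≤ N →
  Σ (Fin p → Fin N) λ r → Injective _≡_ _≡_ r × (∀ t s → w t ≢ r s)
avoiding zero w _ = (λ ()) , (λ {}) , λ _ ()
avoiding {m} {N} (suc p) w m+p+1≤N = x ∷ r , r′-injective , apart′
  where
  previous = avoiding p w (≤-trans (+-monoʳ-≤ m (n≤1+n p)) m+p+1≤N)
  r = proj₁ previous
  apart = proj₂ (proj₂ previous)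
  new = missed-value (joined w r) (subst (_≤ N) (+-suc m p) m+p+1≤N)
  x = proj₁ new
  w≢x : ∀ t → w t ≢ x
  w≢x t = subst (_≢ x) (cong [ w , r ]′ (splitAt-↑ˡ m t p)) (proj₂ new (t ↑ˡ p))
  r≢x : ∀ s → r s ≢ x
  r≢x s = subst (_≢ x) (cong [ w , r ]′ (splitAt-↑ʳ m p s)) (proj₂ new (m ↑ʳ s))
  r′-injective : Injective _≡_ _≡_ (x ∷ r)
  r′-injective {zero}  {zero}   _  = refl
  r′-injective {zero}  {suc s}  eq = contradiction (sym eq) (r≢x s)
  r′-injective {suc s} {zero}   eq = contradiction eq (r≢x s)
  r′-injective {suc s} {suc s′} eq = cong suc (proj₁ (proj₂ previous) eq)
  apart′ : ∀ t s → w t ≢ (x ∷ r) s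
  apart′ t zero    = w≢x t
  apart′ t (suc s) = apart t s

-- The edge (i , j) is among the edges listed by r (as codes in Fin (n²)).
Listed : ∀ {n p} → (Fin p → Fin (n * n)) → Fin n → Fin n → Set
Listed r i j = ∃ λ s → r s ≡ combine i j

-- Give the listed edges fresh colours (odd numbers encoding the edge) and
-- double all other colours.
recolour : ∀ {n p} → (Fin p → Fin (n * n)) → Coloring n → Coloring n
recolour r c i j with any? (λ s → r s Fin.≟ combine i j)
... | yes _ = suc (2 * toℕ (combine i j))
... | no _  = 2 * c i j

recolour-cases : ∀ {n p} (r : Fin p → Fin (n * n)) (c : Coloring n) i j →
  (Listed r i j × recolour r c i j ≡ suc (2 * toℕ (combine i j))) ⊎
  (¬ Listed r i j × recolour r c i j ≡ 2 * c i j)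
recolour-cases r c i j with any? (λ s → r s Fin.≟ combine i j)
... | yes listed = inj₁ (listed , refl)
... | no unlisted = inj₂ (unlisted , refl)

recolour-collision : ∀ {n p} (r : Fin p → Fin (n * n)) (c : Coloring n) {i j i′ j′} →
  recolour r c i j ≡ recolour r c i′ j′ → c i j ≡ c i′ j′ ⊎ (i ≡ i′ × j ≡ j′)
recolour-collision r c {i} {j} {i′} {j′} eq with recolour-cases r c i j | recolour-cases r c i′ j′
... | inj₁ (_ , new) | inj₁ (_ , new′) = inj₂ (combine-injective _ _ _ _
  (toℕ-injective (*-cancelˡ-≡ _ _ 2 (suc-injective (trans (sym new) (trans eq new′))))))
... | inj₂ (_ , old) | inj₂ (_ , old′) = inj₁ (*-cancelˡ-≡ _ _ 2 (trans (sym old) (trans eq old′)))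
... | inj₁ (_ , new) | inj₂ (_ , old′) =
  contradiction (trans (sym old′) (trans (sym eq) new)) (even≢odd (c i′ j′) (toℕ (combine i j)))
... | inj₂ (_ , old) | inj₁ (_ , new′) =
  contradiction (trans (sym old) (trans eq new′)) (even≢odd (c i j) (toℕ (combine i′ j′)))

recolour-proper : ∀ {n p} (r : Fin p → Fin (n * n)) {c : Coloring n} → Proper c → Proper (recolour r c)
recolour-proper r {c} (rows , cols) =
  (λ i j j′ j≢j′ eq → [ rows i j j′ j≢j′ , j≢j′ ∘ proj₂ ]′ (recolour-collision r c eq)) ,
  (λ i i′ j i≢i′ eq → [ cols i i′ j i≢i′ , i≢i′ ∘ proj₁ ]′ (recolour-collision r c eq))

recolour-usesAtLeast : ∀ {n m p} (c : Coloring n) (e₁ e₂ : Fin m → Fin n) →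
  Injective _≡_ _≡_ (λ t → c (e₁ t) (e₂ t)) → (r : Fin p → Fin (n * n)) → Injective _≡_ _≡_ r →
  (∀ t s → combine (e₁ t) (e₂ t) ≢ r s) → UsesAtLeast (m + p) (recolour r c)
recolour-usesAtLeast {n} {m} c e₁ e₂ rainbow r r-injective apart =
  proj₁ ∘ edge , proj₂ ∘ edge , injective-resp (λ x → sym (colour x)) colours-injective
  where
  c′ = recolour r c
  listedEdge : Fin _ → Fin n × Fin n
  listedEdge s = remQuot n (r s)
  edge : Fin (m + _) → Fin n × Fin n
  edge = joined (λ t → e₁ t , e₂ t) listedEdge
  doubled : Fin m → ℕ
  doubled t = 2 * c (e₁ t) (e₂ t)
  fresh : Fin _ → ℕ
  fresh s = suc (2 * toℕ (r s))
  old : ∀ t → c′ (e₁ t) (e₂ t) ≡ doubled t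
  old t with recolour-cases r c (e₁ t) (e₂ t)
  ... | inj₁ ((s , rs≡) , _) = contradiction (sym rs≡) (apart t s)
  ... | inj₂ (_ , recoloured) = recoloured
  new : ∀ s → uncurry c′ (listedEdge s) ≡ fresh s
  new s with recolour-cases r c (proj₁ (listedEdge s)) (proj₂ (listedEdge s))
  ... | inj₁ (_ , recoloured) =
    trans recoloured (cong (λ x → suc (2 * toℕ x)) (combine-remQuot {n} n (r s)))
  ... | inj₂ (unlisted , _)   = contradiction (s , sym (combine-remQuot {n} n (r s))) unlisted
  colour : ∀ x → uncurry c′ (edge x) ≡ joined doubled fresh x
  colour x = trans ([,]-∘ (uncurry c′) (splitAt m x)) ([,]-cong old new (splitAt m x))
  colours-injective : Injective _≡_ _≡_ (joined doubled fresh)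
  colours-injective = joined-injective (rainbow ∘ *-cancelˡ-≡ _ _ 2)
    (r-injective ∘ toℕ-injective ∘ *-cancelˡ-≡ _ _ 2 ∘ suc-injective)
    (λ t s → even≢odd (c (e₁ t) (e₂ t)) (toℕ (r s)))

-- If fewer than n edges are listed, some matching of a decomposition of K_{n,n}
-- avoids all of them: each listed edge lies in one matching, and some matching
-- is hit by none (pigeonhole).
unlisted-matching : ∀ {n p} (σ : Fin n → Permutation′ n) →
  (∀ i j → ∃! _≡_ λ k → σ k ⟨$⟩ʳ i ≡ j) → (r : Fin p → Fin (n * n)) → p < n →
  ∃ λ k → ∀ i → ¬ Listed r i (σ k ⟨$⟩ʳ i)
unlisted-matching {n} σ cover r p<n = k , avoids
  where
  owner : Fin _ → Fin n
  owner s = proj₁ (uncurry cover (remQuot n (r s)))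
  unowned = missed-value owner p<n
  k = proj₁ unowned
  avoids : ∀ i → ¬ Listed r i (σ k ⟨$⟩ʳ i)
  avoids i (s , rs≡) = proj₂ unowned s (begin
    owner s                                      ≡⟨ cong (λ e → proj₁ (uncurry cover e)) edge≡ ⟩
    proj₁ (cover i (σ k ⟨$⟩ʳ i))                 ≡⟨ proj₂ (proj₂ (cover i (σ k ⟨$⟩ʳ i))) refl ⟩
    k                                            ∎)
    where
    open ≡-Reasoning
    edge≡ : remQuot n (r s) ≡ (i , σ k ⟨$⟩ʳ i)
    edge≡ = trans (cong (remQuot n) rs≡) (remQuot-combine i _)

-- A matching avoiding every recoloured edge keeps the doubled old colours, so
-- it is multicolored for the original colouring as soon as it is for the new one.
unlisted-multicolored : ∀ {n p} (r : Fin p → Fin (n * n)) (c : Coloring n) (σ : Permutation′ n) →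
  (∀ i → ¬ Listed r i (σ ⟨$⟩ʳ i)) → Multicolored (recolour r c) σ → Multicolored c σ
unlisted-multicolored r c σ unlisted multicolored eq =
  multicolored (trans (doubled _) (trans (cong (2 *_) eq) (sym (doubled _))))
  where
  doubled : ∀ i → recolour r c i (σ ⟨$⟩ʳ i) ≡ 2 * c i (σ ⟨$⟩ʳ i)
  doubled i with recolour-cases r c i (σ ⟨$⟩ʳ i)
  ... | inj₁ (listed , _) = contradiction listed (unlisted i)
  ... | inj₂ (_ , old)    = old

padding : ∀ p k → L*Prop (suc p) k → p ≤ k → k ≤ suc p * suc p → LProp (suc p) (k ∸ p)
padding p k forced p≤k k≤n² c proper (e₁ , e₂ , rainbow) =
  σ k₀ , unlisted-multicolored r c (σ k₀) (proj₂ unlisted) (proj₁ (proj₂ decomposition) k₀)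
  where
  m+p≡k : k ∸ p + p ≡ k
  m+p≡k = m∸n+n≡m p≤k
  fresh : Σ (Fin p → Fin (suc p * suc p)) λ r →
            Injective _≡_ _≡_ r × (∀ t s → combine (e₁ t) (e₂ t) ≢ r s)
  fresh = avoiding p (λ t → combine (e₁ t) (e₂ t)) (subst (_≤ suc p * suc p) (sym m+p≡k) k≤n²)
  r : Fin p → Fin (suc p * suc p)
  r = proj₁ fresh
  uses : UsesAtLeast k (recolour r c)
  uses = subst (λ x → UsesAtLeast x (recolour r c)) m+p≡k
    (recolour-usesAtLeast c e₁ e₂ rainbow r (proj₁ (proj₂ fresh)) (proj₂ (proj₂ fresh)))
  decomposition : DecomposesIntoMulticolored (recolour r c)
  decomposition = forced (recolour r c) (recolour-proper r proper) uses
  σ : Fin (suc p) → Permutation′ (suc p)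
  σ = proj₁ decomposition
  unlisted : ∃ λ k → ∀ i → ¬ Listed r i (σ k ⟨$⟩ʳ i)
  unlisted = unlisted-matching σ (proj₂ (proj₂ decomposition)) r ≤-refl
  k₀ : Fin (suc p)
  k₀ = proj₁ unlisted

proposition3 : ∀ (n : ℕ) → 1 ≤ n →
    Σ ℕ λ l → Σ ℕ λ l* →
      IsLeast (LProp n) l × IsLeast (L*Prop n) l* × l + (n ∸ 1) ≤ l*
proposition3 (suc p) _ = l , l* , l-least , l*-least , bound
  where
  l-exists : ∃ (IsLeast (LProp (suc p)))
  l-exists = least (LProp? p) (LProp-n² p)
  l*-exists : ∃ (IsLeast (L*Prop (suc p)))
  l*-exists = least (L*Prop? p) (L*Prop-n² p)
  l l* : ℕ
  l = proj₁ l-exists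
  l* = proj₁ l*-exists
  l-least : IsLeast (LProp (suc p)) l
  l-least = proj₂ l-exists
  l*-least : IsLeast (L*Prop (suc p)) l*
  l*-least = proj₂ l*-exists
  p≤l* : p ≤ l*
  p≤l* = L*Prop⇒n∸1≤ (suc p) l* (proj₁ l*-least)
  l≤l*∸p : l ≤ l* ∸ p
  l≤l*∸p = proj₂ l-least _ (padding p l* (proj₁ l*-least) p≤l* (proj₂ l*-least _ (L*Prop-n² p)))
  bound : l + p ≤ l*
  bound = ≤-trans (+-monoˡ-≤ p l≤l*∸p) (≤-reflexive (m∸n+n≡m p≤l*))
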